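{- Let $X$ be a commutable set. For every term $e\in\mathcal{T}X$ with $e\neq 0$, there exists a string $s\in\mathcal{S}X$ such that $s\le e$.
   Context: Pre-Kleene algebra: constants $0,1$, operations $+,\cdot,{}^*$ with $(+,0)$ a commutative idempotent monoid, $(\cdot,1)$ a monoid, two-sided distributivity, $0$ absorbing, and $x^*=1+xx^*$; order $x\le y$ iff $x+y=y$. A commutable set is a set $X$ with a reflexive symmetric relation $\sim$. $\mathcal{S}X$ is the monoid of strings over $X$ modulo $xy=yx$ for $x\sim y$; $\mathcal{T}X$ is the pre-Kleene algebra freely generated by $X$ subject to $xy=yx$ for $x\sim y$, into which $\mathcal{S}X$ embeds. -}

module Defs where

open import Level using (Level; _⊔_; suc)
open import Data.List using (List; []; _∷_)

record CommutableSet (a ℓ : Level) : Set (Level.suc (a ⊔ ℓ)) where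
  field
    Carrier : Set a
    _∼_     : Carrier → Carrier → Set ℓ
    ∼-refl  : ∀ {x} → x ∼ x
    ∼-sym   : ∀ {x y} → x ∼ y → y ∼ x

infixl 6 _⊕_
infixl 7 _⊙_
data Term {a} (A : Set a) : Set a where
  var  : A → Term A
  𝟘 𝟙  : Term A
  _⊕_  : Term A → Term A → Term A
  _⊙_  : Term A → Term A → Term A
  _⋆   : Term A → Term A

module _ {a ℓ} (X : CommutableSet a ℓ) where
  open CommutableSet X

  infix 4 _≈_
  -- The least congruence on terms containing the pre-Kleene algebra axioms
  -- and the commutations  x y = y x  for x ∼ y.  Term X / _≈_ is 𝒯X.
  data _≈_ : Term Carrier → Term Carrier → Set (a ⊔ ℓ) where
    refl  : ∀ {e} → e ≈ e
    sym   : ∀ {e f} → e ≈ f → f ≈ e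
    trans : ∀ {e f g} → e ≈ f → f ≈ g → e ≈ g
    ⊕-cong : ∀ {e e′ f f′} → e ≈ e′ → f ≈ f′ → e ⊕ f ≈ e′ ⊕ f′
    ⊙-cong : ∀ {e e′ f f′} → e ≈ e′ → f ≈ f′ → e ⊙ f ≈ e′ ⊙ f′
    ⋆-cong : ∀ {e e′} → e ≈ e′ → e ⋆ ≈ e′ ⋆
    ⊕-assoc : ∀ e f g → (e ⊕ f) ⊕ g ≈ e ⊕ (f ⊕ g)
    ⊕-comm  : ∀ e f → e ⊕ f ≈ f ⊕ e
    ⊕-idem  : ∀ e → e ⊕ e ≈ e
    ⊕-identityˡ : ∀ e → 𝟘 ⊕ e ≈ e
    ⊙-assoc : ∀ e f g → (e ⊙ f) ⊙ g ≈ e ⊙ (f ⊙ g)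
    ⊙-identityˡ : ∀ e → 𝟙 ⊙ e ≈ e
    ⊙-identityʳ : ∀ e → e ⊙ 𝟙 ≈ e
    distribˡ : ∀ e f g → e ⊙ (f ⊕ g) ≈ (e ⊙ f) ⊕ (e ⊙ g)
    distribʳ : ∀ e f g → (f ⊕ g) ⊙ e ≈ (f ⊙ e) ⊕ (g ⊙ e)
    zeroˡ : ∀ e → 𝟘 ⊙ e ≈ 𝟘
    zeroʳ : ∀ e → e ⊙ 𝟘 ≈ 𝟘
    ⋆-unfold : ∀ e → e ⋆ ≈ 𝟙 ⊕ (e ⊙ (e ⋆))
    comm : ∀ {x y} → x ∼ y → var x ⊙ var y ≈ var y ⊙ var x

  infix 4 _≤_
  _≤_ : Term Carrier → Term Carrier → Set (a ⊔ ℓ)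
  e ≤ f = e ⊕ f ≈ f

  -- Embedding of strings (representatives of elements of 𝒮X) into 𝒯X.
  ⟦_⟧ : List Carrier → Term Carrier
  ⟦ [] ⟧    = 𝟙
  ⟦ x ∷ s ⟧ = var x ⊙ ⟦ s ⟧

-- Every term is either provably 0 or lies above a string, by induction on the term: 0 only
-- arises from 0 itself, sums of two zeros and products with a zero factor (0 is absorbing),
-- a star always lies above the empty string 1, and products of strings are strings.
module Submission where

open import Defs hiding (_≈_; _≤_; ⟦_⟧)
import Defs
open import Level using (_⊔_)
open import Data.List using (List; []; _∷_; _++_)
open import Data.Product using (∃; _,_)
open import Data.Sum using (_⊎_; inj₁; inj₂)
open import Relation.Nullary using (¬_; contradiction)
open import Relation.Binary.Bundles using (Setoid)
import Relation.Binary.Reasoning.Setoid as SetoidReasoning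

module StringsBelow {a ℓ} (X : CommutableSet a ℓ) where
  open CommutableSet X using (Carrier)

  infix 4 _≈_ _≤_

  _≈_ : Term Carrier → Term Carrier → Set (a ⊔ ℓ)
  _≈_ = Defs._≈_ X

  _≤_ : Term Carrier → Term Carrier → Set (a ⊔ ℓ)
  _≤_ = Defs._≤_ X

  ⟦_⟧ : List Carrier → Term Carrier
  ⟦_⟧ = Defs.⟦_⟧ X

  ≈-setoid : Setoid a (a ⊔ ℓ)
  ≈-setoid = record
    { Carrier       = Term Carrier
    ; _≈_           = _≈_
    ; isEquivalence = record { refl = refl ; sym = sym ; trans = trans }
    }

  open SetoidReasoning ≈-setoid

  ≤-refl : ∀ {e} → e ≤ e
  ≤-refl {e} = ⊕-idem e

  ≤-trans : ∀ {e f g} → e ≤ f → f ≤ g → e ≤ g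
  ≤-trans {e} {f} {g} e≤f f≤g = begin
    e ⊕ g        ≈⟨ ⊕-cong refl (sym f≤g) ⟩
    e ⊕ (f ⊕ g)  ≈⟨ sym (⊕-assoc e f g) ⟩
    (e ⊕ f) ⊕ g  ≈⟨ ⊕-cong e≤f refl ⟩
    f ⊕ g        ≈⟨ f≤g ⟩
    g            ∎

  ≤-respˡ-≈ : ∀ {e f g} → e ≈ f → e ≤ g → f ≤ g
  ≤-respˡ-≈ e≈f e≤g = trans (⊕-cong (sym e≈f) refl) e≤g

  ≤-respʳ-≈ : ∀ {e f g} → f ≈ g → e ≤ f → e ≤ g
  ≤-respʳ-≈ f≈g e≤f = trans (⊕-cong refl (sym f≈g)) (trans e≤f f≈g)

  x≤x⊕y : ∀ e f → e ≤ e ⊕ f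
  x≤x⊕y e f = trans (sym (⊕-assoc e e f)) (⊕-cong (⊕-idem e) refl)

  y≤x⊕y : ∀ e f → f ≤ e ⊕ f
  y≤x⊕y e f = ≤-respʳ-≈ (⊕-comm f e) (x≤x⊕y f e)

  ⊙-monoˡ-≤ : ∀ {e e′} f → e ≤ e′ → e ⊙ f ≤ e′ ⊙ f
  ⊙-monoˡ-≤ {e} {e′} f e≤e′ = trans (sym (distribʳ f e e′)) (⊙-cong e≤e′ refl)

  ⊙-monoʳ-≤ : ∀ e {f f′} → f ≤ f′ → e ⊙ f ≤ e ⊙ f′
  ⊙-monoʳ-≤ e {f} {f′} f≤f′ = trans (sym (distribˡ e f f′)) (⊙-cong refl f≤f′)

  ⊙-mono-≤ : ∀ {e e′ f f′} → e ≤ e′ → f ≤ f′ → e ⊙ f ≤ e′ ⊙ f′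
  ⊙-mono-≤ {e′ = e′} {f = f} e≤e′ f≤f′ = ≤-trans (⊙-monoˡ-≤ f e≤e′) (⊙-monoʳ-≤ e′ f≤f′)

  ⟦⟧-++ : ∀ s t → ⟦ s ++ t ⟧ ≈ ⟦ s ⟧ ⊙ ⟦ t ⟧
  ⟦⟧-++ []      t = sym (⊙-identityˡ ⟦ t ⟧)
  ⟦⟧-++ (x ∷ s) t = begin
    var x ⊙ ⟦ s ++ t ⟧           ≈⟨ ⊙-cong refl (⟦⟧-++ s t) ⟩
    var x ⊙ (⟦ s ⟧ ⊙ ⟦ t ⟧)      ≈⟨ sym (⊙-assoc (var x) ⟦ s ⟧ ⟦ t ⟧) ⟩
    (var x ⊙ ⟦ s ⟧) ⊙ ⟦ t ⟧      ∎

  HasStringBelow : Term Carrier → Set (a ⊔ ℓ)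
  HasStringBelow e = ∃ λ (s : List Carrier) → ⟦ s ⟧ ≤ e

  var-hasStringBelow : ∀ x → HasStringBelow (var x)
  var-hasStringBelow x = x ∷ [] , ≤-respˡ-≈ (sym (⊙-identityʳ (var x))) ≤-refl

  𝟙-hasStringBelow : HasStringBelow 𝟙
  𝟙-hasStringBelow = [] , ≤-refl

  ⋆-hasStringBelow : ∀ e → HasStringBelow (e ⋆)
  ⋆-hasStringBelow e = [] , ≤-respʳ-≈ (sym (⋆-unfold e)) (x≤x⊕y 𝟙 (e ⊙ e ⋆))

  ⊕-hasStringBelowˡ : ∀ {e} f → HasStringBelow e → HasStringBelow (e ⊕ f)
  ⊕-hasStringBelowˡ {e} f (s , s≤e) = s , ≤-trans s≤e (x≤x⊕y e f)

  ⊕-hasStringBelowʳ : ∀ e {f} → HasStringBelow f → HasStringBelow (e ⊕ f)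
  ⊕-hasStringBelowʳ e {f} (s , s≤f) = s , ≤-trans s≤f (y≤x⊕y e f)

  ⊙-hasStringBelow : ∀ {e f} → HasStringBelow e → HasStringBelow f → HasStringBelow (e ⊙ f)
  ⊙-hasStringBelow (s , s≤e) (t , t≤f) = s ++ t , ≤-respˡ-≈ (sym (⟦⟧-++ s t)) (⊙-mono-≤ s≤e t≤f)

  ≈𝟘⊎hasStringBelow : ∀ e → e ≈ 𝟘 ⊎ HasStringBelow e
  ≈𝟘⊎hasStringBelow (var x) = inj₂ (var-hasStringBelow x)
  ≈𝟘⊎hasStringBelow 𝟘       = inj₁ refl
  ≈𝟘⊎hasStringBelow 𝟙       = inj₂ 𝟙-hasStringBelow
  ≈𝟘⊎hasStringBelow (e ⋆)   = inj₂ (⋆-hasStringBelow e)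
  ≈𝟘⊎hasStringBelow (e ⊕ f) with ≈𝟘⊎hasStringBelow e | ≈𝟘⊎hasStringBelow f
  ... | inj₂ below-e | _            = inj₂ (⊕-hasStringBelowˡ f below-e)
  ... | inj₁ _       | inj₂ below-f = inj₂ (⊕-hasStringBelowʳ e below-f)
  ... | inj₁ e≈𝟘     | inj₁ f≈𝟘     = inj₁ (trans (⊕-cong e≈𝟘 f≈𝟘) (⊕-identityˡ 𝟘))
  ≈𝟘⊎hasStringBelow (e ⊙ f) with ≈𝟘⊎hasStringBelow e | ≈𝟘⊎hasStringBelow f
  ... | inj₁ e≈𝟘     | _            = inj₁ (trans (⊙-cong e≈𝟘 refl) (zeroˡ f))
  ... | inj₂ _       | inj₁ f≈𝟘     = inj₁ (trans (⊙-cong refl f≈𝟘) (zeroʳ e))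
  ... | inj₂ below-e | inj₂ below-f = inj₂ (⊙-hasStringBelow below-e below-f)

open Defs using (_≈_; _≤_; ⟦_⟧)

mainTheorem7 : ∀ {a ℓ} (X : CommutableSet a ℓ) (e : Term (CommutableSet.Carrier X)) →
    ¬ (_≈_ X e 𝟘) → ∃ λ (s : List (CommutableSet.Carrier X)) → _≤_ X (⟦ X ⟧ s) e
mainTheorem7 X e e≉𝟘 with StringsBelow.≈𝟘⊎hasStringBelow X e
... | inj₁ e≈𝟘  = contradiction e≈𝟘 e≉𝟘
... | inj₂ below = below
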